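{- Let $a, b, k$ be positive integers. If the player cannot win the rotating-table game with parameters $(n, m) = (a, b)$, then the player cannot win the rotating-table game with parameters $(n,m) = (a, bk)$.
   Context: The rotating-table game with parameters $(n,m)$: $n$ counters lie on the vertices (positions $1,\dots,n$, fixed from the player's perspective) of a regular $n$-gon table, each showing an element of $\mathbb{Z}_m$; the initial configuration in $\mathbb{Z}_m^n$ is arbitrary and unknown to the blindfolded player, who receives no information. Each turn the player makes a move $y \in \mathbb{Z}_m^n$, adding $y_i$ to the counter at position $i$; then the table is rotated by an arbitrary (adversarially chosen) rotation, i.e. the counters are cyclically shifted by any amount (possibly zero). A strategy is a fixed finite sequence of moves. The player "can win" if some finite sequence of moves guarantees that, for every initial configuration and every choice of rotations, at some point (initially or after some move) all counters simultaneously show $0$. -}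

module Defs where

open import Data.Nat using (ℕ; zero; suc; NonZero; _≤_)
import Data.Nat as ℕ
open import Data.Fin using (Fin; toℕ)
open import Data.Nat.DivMod using (_mod_)
open import Relation.Binary.PropositionalEquality using (_≡_)
open import Data.List using (List; []; _∷_; length)
open import Data.Product using (∃; Σ; _×_; _,_)

_+ₘ_ : ∀ {m} .{{_ : NonZero m}} → Fin m → Fin m → Fin m
_+ₘ_ {m} x y = (toℕ x ℕ.+ toℕ y) mod m

-- A configuration: value shown by the counter at each (fixed) position.
Config : ℕ → ℕ → Set
Config n m = Fin n → Fin m

AllZero : ∀ {n m} → Config n m → Set
AllZero {n} {m} c = ∀ (i : Fin n) → toℕ (c i) ≡ 0

applyMove : ∀ {n m} .{{_ : NonZero m}} → Config n m → Config n m → Config n m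
applyMove c y i = c i +ₘ y i

-- Rotate the table by r positions: the counter at position i moves to
-- position i + r (mod n), i.e. new config at position i+r is old at i.
rotate : ∀ {n m} .{{_ : NonZero n}} → Fin n → Config n m → Config n m
rotate {n} r c i = c ((toℕ i ℕ.+ (n ℕ.∸ toℕ r)) mod n)

Strategy : ℕ → ℕ → Set
Strategy n m = List (Config n m)

-- Configuration after the first t moves of the strategy (each followed by
-- the adversary's rotation ρ t).
state : ∀ {n m} .{{_ : NonZero n}} .{{_ : NonZero m}} →
        Strategy n m → Config n m → (ℕ → Fin n) → ℕ → Config n m
state ys c ρ zero = c
state [] c ρ (suc t) = c
state (y ∷ ys) c ρ (suc t) = state ys (rotate (ρ 0) (applyMove c y)) (λ s → ρ (suc s)) t

CanWin : (n m : ℕ) .{{_ : NonZero n}} .{{_ : NonZero m}} → Set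
CanWin n m =
  Σ (Strategy n m) λ ys →
    ∀ (c : Config n m) (ρ : ℕ → Fin n) →
      ∃ λ t → (t ≤ length ys) × AllZero (state ys c ρ t)

{-# OPTIONS --safe #-}
module Submission where

-- Reduction mod b is an additive map ℤ_{bk} → ℤ_b that commutes with rotations and
-- has a section, so reducing every move of a winning (a, bk)-strategy gives a winning
-- (a, b)-strategy: play the reduced strategy against a configuration c while the
-- original one is played against a lift of c; the two games stay related by reduction
-- and the reduction of an all-zero configuration is all zero.

open import Defs
open import Data.Nat using (ℕ; NonZero; _*_; _+_; _%_; _≤_; zero; suc)
open import Data.Nat.Properties using (m*n≢0)
open import Data.Nat.DivMod using (_mod_; m∣n⇒o%n%m≡o%m; %-distribˡ-+; m<n⇒m%n≡m; m*n%n≡0)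
open import Data.Nat.Divisibility using (_∣_; ∣⇒≤; m∣m*n)
open import Data.Fin using (Fin; toℕ; inject≤)
open import Data.Fin.Properties using (toℕ-fromℕ<; toℕ-injective; toℕ-inject≤; toℕ<n)
open import Data.List using (_∷_; []; map; length)
open import Data.List.Properties using (length-map)
open import Data.Product using (∃; _×_; _,_)
open import Function.Base using (_∘_; it)
open import Relation.Binary.PropositionalEquality using (_≡_; sym; trans; cong; cong₂; subst; module ≡-Reasoning)
open import Relation.Nullary using (¬_)

toℕ-mod : ∀ x n .{{_ : NonZero n}} → toℕ (x mod n) ≡ x % n
toℕ-mod x n = toℕ-fromℕ< _

module _ {n m m′ : ℕ} .{{_ : NonZero n}} .{{_ : NonZero m}} .{{_ : NonZero m′}}
         (f : Fin m′ → Fin m) (f-+ₘ : ∀ x y → f (x +ₘ y) ≡ f x +ₘ f y) where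

  state-map : ∀ ys (c′ : Config n m′) c (ρ : ℕ → Fin n) t →
              (∀ i → f (c′ i) ≡ c i) →
              ∀ i → f (state ys c′ ρ t i) ≡ state (map (f ∘_) ys) c ρ t i
  state-map ys       c′ c ρ zero    f∘c′≗c = f∘c′≗c
  state-map []       c′ c ρ (suc t) f∘c′≗c = f∘c′≗c
  state-map (y ∷ ys) c′ c ρ (suc t) f∘c′≗c =
    state-map ys _ _ (ρ ∘ suc) t
      (λ i → trans (f-+ₘ (c′ _) (y _)) (cong (_+ₘ f (y _)) (f∘c′≗c _)))

reduce : ∀ m {m′} .{{_ : NonZero m}} → Fin m′ → Fin m
reduce m x = toℕ x mod m

module _ {m m′ : ℕ} .{{_ : NonZero m}} .{{_ : NonZero m′}} (m∣m′ : m ∣ m′) where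

  reduce-+ₘ : ∀ (x y : Fin m′) → reduce m (x +ₘ y) ≡ reduce m x +ₘ reduce m y
  reduce-+ₘ x y = toℕ-injective (begin
    toℕ (reduce m (x +ₘ y))                    ≡⟨ toℕ-mod _ m ⟩
    toℕ (x +ₘ y) % m                           ≡⟨ cong (_% m) (toℕ-mod _ m′) ⟩
    (toℕ x + toℕ y) % m′ % m                   ≡⟨ m∣n⇒o%n%m≡o%m m m′ _ m∣m′ ⟩
    (toℕ x + toℕ y) % m                        ≡⟨ %-distribˡ-+ (toℕ x) (toℕ y) m ⟩
    (toℕ x % m + toℕ y % m) % m                ≡⟨ cong₂ (λ u v → (u + v) % m) (sym (toℕ-mod _ m)) (sym (toℕ-mod _ m)) ⟩
    (toℕ (reduce m x) + toℕ (reduce m y)) % m  ≡⟨ sym (toℕ-mod _ m) ⟩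
    toℕ (reduce m x +ₘ reduce m y)             ∎)
    where open ≡-Reasoning

  reduce-inject≤ : ∀ (x : Fin m) → reduce m (inject≤ x (∣⇒≤ m∣m′)) ≡ x
  reduce-inject≤ x = toℕ-injective (begin
    toℕ (reduce m (inject≤ x _))  ≡⟨ toℕ-mod _ m ⟩
    toℕ (inject≤ x _) % m         ≡⟨ cong (_% m) (toℕ-inject≤ x _) ⟩
    toℕ x % m                     ≡⟨ m<n⇒m%n≡m (toℕ<n x) ⟩
    toℕ x                         ∎)
    where open ≡-Reasoning

reduce-AllZero : ∀ {n m m′} .{{_ : NonZero m}} (c : Config n m′) →
                 AllZero c → AllZero (reduce m ∘ c)
reduce-AllZero {m = m} c c≡0 i = trans (toℕ-mod _ m) (trans (cong (_% m) (c≡0 i)) (m*n%n≡0 0 m))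

CanWin-reduce : ∀ {n m m′} .{{_ : NonZero n}} .{{_ : NonZero m}} .{{_ : NonZero m′}} →
                m ∣ m′ → CanWin n m′ → CanWin n m
CanWin-reduce {n} {m} {m′} m∣m′ (ys , wins) = reduced , λ c ρ → won c ρ (wins (lift c) ρ)
  where
  reduced : Strategy n m
  reduced = map (reduce m ∘_) ys

  lift : Config n m → Config n m′
  lift c i = inject≤ (c i) (∣⇒≤ m∣m′)

  lifted-game-reduces : ∀ c ρ t i → reduce m (state ys (lift c) ρ t i) ≡ state reduced c ρ t i
  lifted-game-reduces c ρ t =
    state-map (reduce m) (reduce-+ₘ m∣m′) ys (lift c) c ρ t (reduce-inject≤ m∣m′ ∘ c)

  won : ∀ c ρ → ∃ (λ t → t ≤ length ys × AllZero (state ys (lift c) ρ t)) →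
                ∃ (λ t → t ≤ length reduced × AllZero (state reduced c ρ t))
  won c ρ (t , t≤len , zero-at-t) =
    t , subst (t ≤_) (sym (length-map _ ys)) t≤len ,
    λ i → trans (cong toℕ (sym (lifted-game-reduces c ρ t i)))
                (reduce-AllZero (state ys (lift c) ρ t) zero-at-t i)

lemma3p2 : (a b k : ℕ) .{{_ : NonZero a}} .{{_ : NonZero b}} .{{_ : NonZero k}} →
    ¬ CanWin a b → ¬ CanWin a (b * k) {{it}} {{m*n≢0 b k}}
lemma3p2 a b k ¬win win = ¬win (CanWin-reduce {{_}} {{_}} {{m*n≢0 b k}} (m∣m*n k) win)
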